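{- As $n\to\infty$, $v(n)\le n^{3/4+o(1)}$; that is, for every $\epsilon>0$ there is $n_0$ such that $v(n)\le n^{3/4+\epsilon}$ for all $n\ge n_0$.
   Context: For an integer $n\ge 2$ let $G_n=\{(a,b)\in\mathbb{Z}^2 : ab\equiv 1 \pmod n,\ 1\le a,b\le n-1\}$, let $C_n$ be the convex hull of $G_n$ in $\mathbb{R}^2$, and let $v(n)$ be the number of vertices of $C_n$. -}

module Defs where

open import Data.Nat as ℕ using (ℕ; _∸_; _^_)
open import Data.Nat.Divisibility using (_∣_)
open import Data.Integer using (+_)
open import Data.Rational as ℚ using (ℚ; 0ℚ; 1ℚ; _/_)
open import Data.Product using (_×_; _,_; ∃)
open import Data.List using (List; []; _∷_; length)
open import Data.List.Relation.Unary.All using (All)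
open import Data.List.Relation.Unary.Unique.Propositional using (Unique)
open import Relation.Binary.PropositionalEquality using (_≡_; _≢_)
open import Relation.Nullary using (¬_)

-- Lattice points with natural coordinates (all points of G_n have positive coordinates).
Point : Set
Point = ℕ × ℕ

ℕ→ℚ : ℕ → ℚ
ℕ→ℚ k = + k / 1

-- (a , b) ∈ G_n :  1 ≤ a,b ≤ n-1  and  a b ≡ 1 (mod n)   (a b ≥ 1, so n ∣ a b - 1)
InG : ℕ → Point → Set
InG n (a , b) =
  (1 ℕ.≤ a) × (a ℕ.≤ n ∸ 1) × (1 ℕ.≤ b) × (b ℕ.≤ n ∸ 1) × (n ∣ a ℕ.* b ∸ 1)

weightSum : List (ℚ × Point) → ℚ
weightSum [] = 0ℚ
weightSum ((w , _) ∷ ws) = w ℚ.+ weightSum ws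

xSum : List (ℚ × Point) → ℚ
xSum [] = 0ℚ
xSum ((w , (x , _)) ∷ ws) = w ℚ.* ℕ→ℚ x ℚ.+ xSum ws

ySum : List (ℚ × Point) → ℚ
ySum [] = 0ℚ
ySum ((w , (_ , y)) ∷ ws) = w ℚ.* ℕ→ℚ y ℚ.+ ySum ws

InHullOfOthers : ℕ → Point → Set
InHullOfOthers n p@(a , b) =
  ∃ λ (ws : List (ℚ × Point)) →
    All (λ { (w , q) → (0ℚ ℚ.≤ w) × InG n q × (q ≢ p) }) ws
    × weightSum ws ≡ 1ℚ × xSum ws ≡ ℕ→ℚ a × ySum ws ≡ ℕ→ℚ b

-- p is a vertex of C_n = conv(G_n): p ∈ G_n and p is not in conv(G_n \ {p})
-- (for a finite set S, the vertices of conv S are exactly such points of S).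
IsVertex : ℕ → Point → Set
IsVertex n p = InG n p × ¬ InHullOfOthers n p

-- Vertex list of C_n: a duplicate-free list of vertices of C_n.
-- "v(n) satisfies P" is expressed as: every such list has length satisfying P
-- (applied with monotone P; v(n) itself is the length of the full vertex list).
IsVertexList : ℕ → List Point → Set
IsVertexList n vs = Unique vs × All (IsVertex n) vs

{-# OPTIONS --safe #-}
module Submission where

-- The vertices of C_n have pairwise distinct abscissae (a determines its inverse b modulo n),
-- and none of them is a convex combination of the others.  The chord AB from the leftmost to
-- the rightmost vertex splits them into a convex chain below AB, a concave chain above it and
-- at most two points on it.  Along such a chain in [0, n]² the edge vectors have strictly
-- increasing slopes, total run at most n and total |rise| at most 2n.  Fix K ≈ n^(1/4): an
-- edge with run > K or |slope| > K uses at least K of that budget, and the remaining edges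
-- have slopes p/q with q ≤ K and |p/q| ≤ K, which are 1/K² apart, so there are at most
-- 2K³ + 1 of them.  Hence K·v(n) = O(n + K⁴) = O(n), i.e. v(n)⁴ ≤ 16⁵ n³, and the stated
-- bound follows as soon as n ≥ (16⁵)^(q+1).

open import Defs
open import Data.Nat using (ℕ; suc; z≤n; s≤s)
open import Data.Product using (∃; _×_; _,_; proj₁; proj₂)
open import Data.List using (List; []; _∷_; length; map; filter)
open import Data.List.Relation.Unary.All as All using (All; []; _∷_)
open import Data.List.Relation.Unary.AllPairs using (AllPairs; []; _∷_)
open import Data.List.Relation.Unary.Linked using (Linked; []; [-]; _∷_)
open import Relation.Binary.PropositionalEquality
open import Relation.Nullary using (¬_; yes; no; contradiction)

module ListFacts where
  open import Data.Nat
  open import Data.Nat.Properties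

  allPairs-restrict : ∀ {A : Set} {P : A → Set} {R S : A → A → Set} → (∀ {x y} → P x → P y → R x y → S x y) →
                      ∀ {xs} → All P xs → AllPairs R xs → AllPairs S xs
  allPairs-restrict f [] [] = []
  allPairs-restrict f (px ∷ pxs) (rx ∷ rxs) = All.zipWith (λ (py , r) → f px py r) (pxs , rx) ∷ allPairs-restrict f pxs rxs

  length-increasing≤ : ∀ {lo M} xs → AllPairs _<_ xs → All (lo ≤_) xs → All (_≤ M) xs →
                       length xs ≤ suc M ∸ lo
  length-increasing≤ [] _ _ _ = z≤n
  length-increasing≤ {lo} {M} (x ∷ xs) (x<xs ∷ inc) (lo≤x ∷ _) (x≤M ∷ ≤M) = begin
    suc (length xs)  ≤⟨ s≤s (length-increasing≤ xs inc x<xs ≤M) ⟩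
    suc (M ∸ x)      ≡⟨ sym (+-∸-assoc 1 x≤M) ⟩
    suc M ∸ x        ≤⟨ ∸-monoʳ-≤ (suc M) lo≤x ⟩
    suc M ∸ lo       ∎
    where open ≤-Reasoning

module IntegerFacts where
  open import Data.Integer hiding (suc)
  open import Data.Integer.Properties
    using (*-cancelˡ-<-nonNeg; *-zeroʳ; pos-*; pos-+; +-injective; m-n≡m⊖n; ⊖-≥; ⊖-≤; ≤⇒≯; neg-mono-≤)
  import Data.Nat as ℕ
  import Data.Nat.Properties as ℕ

  0<+ : ∀ {i j} → 0ℤ < i → 0ℤ < j → 0ℤ < i + j
  0<+ (+<+ (s≤s _)) (+<+ (s≤s _)) = +<+ (s≤s z≤n)

  0<+0≤ : ∀ {i j} → 0ℤ < i → 0ℤ ≤ j → 0ℤ < i + j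
  0<+0≤ (+<+ (s≤s _)) (+≤+ _) = +<+ (s≤s z≤n)

  0<* : ∀ {i j} → 0ℤ < i → 0ℤ < j → 0ℤ < i * j
  0<* (+<+ (s≤s _)) (+<+ (s≤s _)) = +<+ (s≤s z≤n)

  0≤* : ∀ {i j} → 0ℤ ≤ i → 0ℤ ≤ j → 0ℤ ≤ i * j
  0≤* (+≤+ {n = m} _) (+≤+ {n = n} _) = subst (0ℤ ≤_) (pos-* m n) (+≤+ z≤n)

  0<*-cancelˡ : ∀ a {j} → 0ℤ < + a * j → 0ℤ < j
  0<*-cancelˡ a 0<aj = *-cancelˡ-<-nonNeg (+ a) (subst (_< + a * _) (sym (*-zeroʳ (+ a))) 0<aj)

  +-+≡+∸ : ∀ {m n} → m ℕ.≤ n → + n - + m ≡ + (n ℕ.∸ m)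
  +-+≡+∸ {m} {n} m≤n = trans (m-n≡m⊖n n m) (⊖-≥ m≤n)

  0≤+-+ : ∀ {m n} → m ℕ.≤ n → 0ℤ ≤ + n - + m
  0≤+-+ m≤n rewrite +-+≡+∸ m≤n = +≤+ z≤n

  0<+-+ : ∀ {m n} → m ℕ.< n → 0ℤ < + n - + m
  0<+-+ m<n rewrite +-+≡+∸ (ℕ.<⇒≤ m<n) = +<+ (ℕ.m<n⇒0<n∸m m<n)

  ∣i+n∣≡i+n : ∀ i n → ∣ i ∣ ℕ.≤ n → + ∣ i + + n ∣ ≡ i + + n
  ∣i+n∣≡i+n (+ _) n _ = refl
  ∣i+n∣≡i+n -[1+ m ] n m<n rewrite ⊖-≥ m<n = refl

  ∣i+n∣≤n+n : ∀ i n → ∣ i ∣ ℕ.≤ n → ∣ i + + n ∣ ℕ.≤ n ℕ.+ n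
  ∣i+n∣≤n+n (+ m) n m≤n = ℕ.+-monoˡ-≤ n m≤n
  ∣i+n∣≤n+n -[1+ m ] n m<n rewrite ⊖-≥ m<n = ℕ.≤-trans (ℕ.m∸n≤m n (suc m)) (ℕ.m≤m+n n n)

  <-pos-gap : ∀ {m n c} → 0ℤ < c → + m ≡ + n + c → n ℕ.< m
  <-pos-gap {m} {n} (+<+ {n = suc c} _) eq =
    subst (n ℕ.<_) (+-injective (trans (pos-+ n (suc c)) (sym eq))) (ℕ.m<m+n n (s≤s z≤n))

  0<⊖ : ∀ {m n} → n ℕ.< m → 0ℤ < m ⊖ n
  0<⊖ n<m rewrite ⊖-≥ (ℕ.<⇒≤ n<m) = +<+ (ℕ.m<n⇒0<n∸m n<m)

  0<⊖⇒< : ∀ {m n} → 0ℤ < m ⊖ n → n ℕ.< m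
  0<⊖⇒< {m} {n} pos with n ℕ.<? m
  ... | yes n<m = n<m
  ... | no n≮m rewrite ⊖-≤ (ℕ.≮⇒≥ n≮m) = contradiction pos (≤⇒≯ (neg-mono-≤ (+≤+ z≤n)))

module SlopeOrder where
  open IntegerFacts
  open import Data.Integer hiding (suc)
  import Data.Nat as ℕ
  import Data.Integer.Tactic.RingSolver as Ring

  -- (k , b) encodes the vector (k + 1, b), so every step has positive run.
  Step : Set
  Step = ℕ × ℤ

  run : Step → ℕ
  run (k , _) = suc k

  rise : Step → ℤ
  rise (_ , b) = b

  cross : Step → Step → ℤ
  cross u v = + run u * rise v - rise u * + run v

  _≺_ : Step → Step → Set
  u ≺ v = 0ℤ < cross u v

  totalRun : List Step → ℕ
  totalRun [] = 0
  totalRun (v ∷ V) = run v ℕ.+ totalRun V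

  totalRise : List Step → ℕ
  totalRise [] = 0
  totalRise (v ∷ V) = ∣ rise v ∣ ℕ.+ totalRise V

  0<run : ∀ u → 0ℤ < + run u
  0<run _ = +<+ (s≤s z≤n)

  ≺-trans : ∀ {u v w} → u ≺ v → v ≺ w → u ≺ w
  ≺-trans {u} {v} {w} u≺v v≺w =
    0<*-cancelˡ (run v) (subst (0ℤ <_) (sym (plücker (+ run u) (rise u) (+ run v) (rise v) (+ run w) (rise w)))
      (0<+ (0<* (0<run u) v≺w) (0<* (0<run w) u≺v)))
    where
    plücker : ∀ a b c d e f → c * (a * f - b * e) ≡ a * (c * f - d * e) + e * (a * d - b * c)
    plücker = Ring.solve-∀

  ≺-rise-pos : ∀ {u v} → u ≺ v → 0ℤ < rise u → 0ℤ < rise v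
  ≺-rise-pos {u} {v} u≺v rise>0 =
    0<*-cancelˡ (run u) (subst (0ℤ <_) (sym (split (+ run u) (rise v) (rise u) (+ run v)))
      (0<+ u≺v (0<* rise>0 (0<run v))))
    where
    split : ∀ a b c d → a * b ≡ (a * b - c * d) + c * d
    split = Ring.solve-∀

module SlopeCount (K : ℕ) where
  open SlopeOrder
  open ListFacts
  open IntegerFacts using (∣i+n∣≡i+n; ∣i+n∣≤n+n; <-pos-gap)
  open import Data.Nat
  open import Data.Nat.Properties
  open import Data.Nat.DivMod using (_/_; m/n*n≤m; m*n/n≡m; /-monoˡ-≤)
  open import Data.Nat.Tactic.RingSolver using (solve-∀)
  open import Data.Integer as ℤ using (+_; ∣_∣)
  import Data.Integer.Properties as ℤP
  import Data.Integer.Tactic.RingSolver as ZRing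
  open import Data.Empty using (⊥-elim)
  open import Data.List.Properties using (length-map; filter-accept; filter-reject)
  import Data.List.Relation.Unary.All.Properties as AllP
  import Data.List.Relation.Unary.AllPairs.Properties as AllPairsP
  open import Relation.Nullary.Decidable using (_×-dec_)
  open import Relation.Unary using (Decidable)

  Short : Step → Set
  Short v = run v ≤ K × ∣ rise v ∣ ≤ K * run v

  short? : Decidable Short
  short? v = run v ≤? K ×-dec ∣ rise v ∣ ≤? K * run v

  ¬short⇒K≤size : ∀ v → ¬ Short v → K ≤ run v + ∣ rise v ∣
  ¬short⇒K≤size v ¬short with run v ≤? K | ∣ rise v ∣ ≤? K * run v
  ... | no run≰K | _ = ≤-trans (<⇒≤ (≰⇒> run≰K)) (m≤m+n (run v) _)
  ... | yes _ | no rise≰ = ≤-trans (≤-trans (m≤m*n K (run v)) (<⇒≤ (≰⇒> rise≰))) (m≤n+m _ (run v))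
  ... | yes run≤K | yes rise≤ = ⊥-elim (¬short (run≤K , rise≤))

  -- run v · (slope v + K); on short steps rise + K·run ≥ 0, so the absolute value is harmless.
  lift : Step → ℕ
  lift v = ∣ rise v ℤ.+ + (K * run v) ∣

  lift-cross : ∀ {u v} → Short u → Short v → u ≺ v → lift u * run v < lift v * run u
  lift-cross {u} {v} (_ , su) (_ , sv) u≺v = <-pos-gap u≺v (begin
    + (lift v * run u)                               ≡⟨ ℤP.pos-* (lift v) (run u) ⟩
    + lift v ℤ.* + run u                             ≡⟨ cong (ℤ._* + run u) (∣i+n∣≡i+n (rise v) _ sv) ⟩
    (rise v ℤ.+ + (K * run v)) ℤ.* + run u           ≡⟨ cong (λ t → (rise v ℤ.+ t) ℤ.* + run u) (ℤP.pos-* K (run v)) ⟩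
    (rise v ℤ.+ + K ℤ.* + run v) ℤ.* + run u         ≡⟨ shift (rise u) (rise v) (+ K) (+ run u) (+ run v) ⟩
    (rise u ℤ.+ + K ℤ.* + run u) ℤ.* + run v ℤ.+ cross u v
      ≡⟨ cong (λ t → (rise u ℤ.+ t) ℤ.* + run v ℤ.+ cross u v) (sym (ℤP.pos-* K (run u))) ⟩
    (rise u ℤ.+ + (K * run u)) ℤ.* + run v ℤ.+ cross u v
      ≡⟨ cong (λ t → t ℤ.* + run v ℤ.+ cross u v) (sym (∣i+n∣≡i+n (rise u) _ su)) ⟩
    + lift u ℤ.* + run v ℤ.+ cross u v               ≡⟨ cong (ℤ._+ cross u v) (sym (ℤP.pos-* (lift u) (run v))) ⟩
    + (lift u * run v) ℤ.+ cross u v                 ∎)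
    where
    open ≡-Reasoning
    shift : ∀ bu bv k au av → (bv ℤ.+ k ℤ.* av) ℤ.* au ≡ (bu ℤ.+ k ℤ.* au) ℤ.* av ℤ.+ (au ℤ.* bv ℤ.- bu ℤ.* av)
    shift = ZRing.solve-∀

  -- Distinct fractions with denominators at most K are at least 1/K² apart.
  floor-gap : ∀ {A B a b} .{{_ : NonZero a}} .{{_ : NonZero b}} → a ≤ K → b ≤ K →
              A * b < B * a → K * K * A / a < K * K * B / b
  floor-gap {A} {B} {a} {b} a≤K b≤K gap = begin
    suc q                ≡⟨ sym (m*n/n≡m (suc q) b) ⟩
    suc q * b / b        ≤⟨ /-monoˡ-≤ b (*-cancelʳ-≤ (suc q * b) (K * K * B) a scaled) ⟩
    K * K * B / b        ∎
    where
    open ≤-Reasoning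
    q = K * K * A / a
    scaled : suc q * b * a ≤ K * K * B * a
    scaled = begin
      suc q * b * a              ≡⟨ expand q a b ⟩
      q * a * b + a * b          ≤⟨ +-mono-≤ (*-monoˡ-≤ b (m/n*n≤m (K * K * A) a)) (*-mono-≤ a≤K b≤K) ⟩
      K * K * A * b + K * K      ≡⟨ collect K A b ⟩
      K * K * suc (A * b)        ≤⟨ *-monoʳ-≤ (K * K) gap ⟩
      K * K * (B * a)            ≡⟨ *-assoc (K * K) B a ⟨
      K * K * B * a              ∎
      where
      expand : ∀ q a b → suc q * b * a ≡ q * a * b + a * b
      expand = solve-∀
      collect : ∀ k A b → k * k * A * b + k * k ≡ k * k * suc (A * b)
      collect = solve-∀

  -- ⌊K² (slope + K)⌋, which lies in [0, 2K³] on short steps.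
  slopeIndex : Step → ℕ
  slopeIndex v@(k , _) = K * K * lift v / suc k

  slopeIndex-< : ∀ {u v} → Short u → Short v → u ≺ v → slopeIndex u < slopeIndex v
  slopeIndex-< {u@(_ , _)} {v@(_ , _)} su sv u≺v = floor-gap (proj₁ su) (proj₁ sv) (lift-cross {u} {v} su sv u≺v)

  slopeIndex-≤ : ∀ {v} → Short v → slopeIndex v ≤ 2 * (K * K * K)
  slopeIndex-≤ {v@(k , b)} (_ , s) = begin
    K * K * lift v / suc k           ≤⟨ /-monoˡ-≤ (suc k) (*-monoʳ-≤ (K * K) (∣i+n∣≤n+n b _ s)) ⟩
    K * K * (K * suc k + K * suc k) / suc k  ≡⟨ cong (_/ suc k) (cube K (suc k)) ⟩
    2 * (K * K * K) * suc k / suc k        ≡⟨ m*n/n≡m (2 * (K * K * K)) (suc k) ⟩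
    2 * (K * K * K)                        ∎
    where
    open ≤-Reasoning
    cube : ∀ k a → k * k * (k * a + k * a) ≡ 2 * (k * k * k) * a
    cube = solve-∀

  length-short≤ : ∀ V → AllPairs _≺_ V → length (filter short? V) ≤ suc (2 * (K * K * K))
  length-short≤ V increasing = begin
    length (filter short? V)                  ≡⟨ length-map slopeIndex (filter short? V) ⟨
    length (map slopeIndex (filter short? V)) ≤⟨ length-increasing≤ _ indices-increasing indices≥0 indices≤ ⟩
    suc (2 * (K * K * K))                     ∎
    where
    open ≤-Reasoning
    shorts : All Short (filter short? V)
    shorts = AllP.all-filter short? V
    indices-increasing : AllPairs _<_ (map slopeIndex (filter short? V))
    indices-increasing = AllPairsP.map⁺
      (allPairs-restrict (λ {u} {v} → slopeIndex-< {u} {v}) shorts (AllPairsP.filter⁺ short? increasing))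
    indices≥0 : All (0 ≤_) (map slopeIndex (filter short? V))
    indices≥0 = All.universal (λ _ → z≤n) _
    indices≤ : All (_≤ 2 * (K * K * K)) (map slopeIndex (filter short? V))
    indices≤ = AllP.map⁺ (All.map (λ {v} → slopeIndex-≤ {v}) shorts)

  length≤totals+short : ∀ V → K * length V ≤ totalRun V + totalRise V + K * length (filter short? V)
  length≤totals+short [] = ≤-refl
  length≤totals+short (v ∷ V) with short? v
  ... | yes short = begin
    K * suc (length V)               ≡⟨ *-suc K _ ⟩
    K + K * length V                 ≤⟨ +-monoʳ-≤ K (length≤totals+short V) ⟩
    K + (R + A + K * F)              ≤⟨ m≤m+n _ (run v + ∣ rise v ∣) ⟩
    K + (R + A + K * F) + (run v + ∣ rise v ∣)  ≡⟨ shuffle K (run v) R ∣ rise v ∣ A F ⟩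
    run v + R + (∣ rise v ∣ + A) + K * suc F
      ≡⟨ cong (λ xs → run v + R + (∣ rise v ∣ + A) + K * length xs) (filter-accept short? {v} {V} short) ⟨
    _                                           ∎
    where
    open ≤-Reasoning
    R = totalRun V
    A = totalRise V
    F = length (filter short? V)
    shuffle : ∀ K r R a A F → K + (R + A + K * F) + (r + a) ≡ r + R + (a + A) + K * suc F
    shuffle = solve-∀
  ... | no long = begin
    K * suc (length V)               ≡⟨ *-suc K _ ⟩
    K + K * length V                 ≤⟨ +-mono-≤ (¬short⇒K≤size v long) (length≤totals+short V) ⟩
    (run v + ∣ rise v ∣) + (R + A + K * F)      ≡⟨ shuffle (run v) R ∣ rise v ∣ A (K * F) ⟩
    run v + R + (∣ rise v ∣ + A) + K * F
      ≡⟨ cong (λ xs → run v + R + (∣ rise v ∣ + A) + K * length xs) (filter-reject short? {v} {V} long) ⟨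
    _                                           ∎
    where
    open ≤-Reasoning
    R = totalRun V
    A = totalRise V
    F = length (filter short? V)
    shuffle : ∀ r R a A t → (r + a) + (R + A + t) ≡ r + R + (a + A) + t
    shuffle = solve-∀

  length-increasingSlopes≤ : ∀ V → AllPairs _≺_ V →
    K * length V ≤ totalRun V + totalRise V + K * suc (2 * (K * K * K))
  length-increasingSlopes≤ V increasing =
    ≤-trans (length≤totals+short V) (+-monoʳ-≤ _ (*-monoʳ-≤ K (length-short≤ V increasing)))

module Chains where
  open SlopeOrder
  open IntegerFacts using (0<⊖; 0<⊖⇒<)
  open import Data.Nat
  open import Data.Nat.Properties
  open import Data.Nat.Tactic.RingSolver using (solve-∀)
  open import Data.Integer using (∣_∣; _⊖_)
  import Data.Integer.Properties as ℤP
  open import Data.List.Relation.Unary.Linked.Properties using (Linked⇒AllPairs)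
  import Data.List.Relation.Unary.Linked as Linked

  X Y : Point → ℕ
  X = proj₁
  Y = proj₂

  _<ₓ_ : Point → Point → Set
  p <ₓ q = X p < X q

  InBox : ℕ → Point → Set
  InBox n p = X p ≤ n × Y p ≤ n

  -- Meaningful only when X p < X q; the run is then X q − X p.
  step : Point → Point → Step
  step p q = (X q ∸ suc (X p) , Y q ⊖ Y p)

  steps : List Point → List Step
  steps (p ∷ q ∷ cs) = step p q ∷ steps (q ∷ cs)
  steps _ = []

  length≤suc-steps : ∀ cs → length cs ≤ suc (length (steps cs))
  length≤suc-steps [] = z≤n
  length≤suc-steps (_ ∷ []) = s≤s z≤n
  length≤suc-steps (_ ∷ q ∷ cs) = s≤s (length≤suc-steps (q ∷ cs))

  run-step : ∀ {p q} → p <ₓ q → run (step p q) + X p ≡ X q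
  run-step {p} {q} p<q = trans (sym (+-suc (X q ∸ suc (X p)) (X p))) (m∸n+n≡m p<q)

  total-run≤ : ∀ {n} p cs → Linked _<ₓ_ (p ∷ cs) → All (InBox n) (p ∷ cs) →
               totalRun (steps (p ∷ cs)) + X p ≤ n
  total-run≤ p [] _ ((x≤n , _) ∷ _) = x≤n
  total-run≤ {n} p (q ∷ cs) (p<q ∷ increasing) (_ ∷ inBox) = begin
    run (step p q) + R + X p   ≡⟨ shuffle (run (step p q)) R (X p) ⟩
    R + (run (step p q) + X p) ≡⟨ cong (λ t → R + t) (run-step {p} {q} p<q) ⟩
    R + X q                    ≤⟨ total-run≤ q cs increasing inBox ⟩
    n                          ∎
    where
    open ≤-Reasoning
    R = totalRun (steps (q ∷ cs))
    shuffle : ∀ a R x → a + R + x ≡ R + (a + x)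
    shuffle = solve-∀

  ascending-tail≤ : ∀ {n} p q cs → Linked _≺_ (steps (p ∷ q ∷ cs)) → Y p < Y q → All (InBox n) (q ∷ cs) →
                    totalRise (steps (q ∷ cs)) + Y q ≤ n

  ascending-rise≤ : ∀ {n} p q cs → Linked _≺_ (steps (p ∷ q ∷ cs)) → Y p < Y q → All (InBox n) (p ∷ q ∷ cs) →
                    totalRise (steps (p ∷ q ∷ cs)) + Y p ≤ n
  ascending-rise≤ {n} p q cs convex p<q (_ ∷ inBox) = begin
    ∣ Y q ⊖ Y p ∣ + A + Y p
      ≡⟨ cong (λ t → t + A + Y p) (trans (ℤP.∣m⊖n∣≡∣n⊖m∣ (Y q) (Y p)) (ℤP.∣⊖∣-≤ (<⇒≤ p<q))) ⟩
    (Y q ∸ Y p) + A + Y p      ≡⟨ shuffle (Y q ∸ Y p) A (Y p) ⟩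
    A + ((Y q ∸ Y p) + Y p)    ≡⟨ cong (λ t → A + t) (m∸n+n≡m (<⇒≤ p<q)) ⟩
    A + Y q                    ≤⟨ ascending-tail≤ p q cs convex p<q inBox ⟩
    n                          ∎
    where
    open ≤-Reasoning
    A = totalRise (steps (q ∷ cs))
    shuffle : ∀ a A y → a + A + y ≡ A + (a + y)
    shuffle = solve-∀

  ascending-tail≤ p q [] _ _ ((_ , y≤n) ∷ _) = y≤n
  ascending-tail≤ p q (r ∷ cs) (pq≺qr ∷ convex) p<q inBox =
    ascending-rise≤ q r cs convex (0<⊖⇒< (≺-rise-pos {step p q} pq≺qr (0<⊖ p<q))) inBox

  total-rise≤ : ∀ {n} p cs → Linked _≺_ (steps (p ∷ cs)) → All (InBox n) (p ∷ cs) →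
                totalRise (steps (p ∷ cs)) ≤ Y p + n
  total-rise≤ p [] _ _ = z≤n
  total-rise≤ {n} p (q ∷ cs) convex inBox@(_ ∷ inBox′) with Y p <? Y q
  ... | yes p<q = ≤-trans (≤-trans (m≤m+n _ (Y p)) (ascending-rise≤ p q cs convex p<q inBox)) (m≤n+m n (Y p))
  ... | no p≮q = begin
    ∣ Y q ⊖ Y p ∣ + A          ≡⟨ cong (_+ A) (ℤP.∣⊖∣-≤ (≮⇒≥ p≮q)) ⟩
    (Y p ∸ Y q) + A            ≤⟨ +-monoʳ-≤ (Y p ∸ Y q) (total-rise≤ q cs (Linked.tail convex) inBox′) ⟩
    (Y p ∸ Y q) + (Y q + n)    ≡⟨ +-assoc (Y p ∸ Y q) (Y q) n ⟨
    (Y p ∸ Y q) + Y q + n      ≡⟨ cong (_+ n) (m∸n+n≡m (≮⇒≥ p≮q)) ⟩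
    Y p + n                    ∎
    where
    open ≤-Reasoning
    A = totalRise (steps (q ∷ cs))

  chainBound : ℕ → ℕ → ℕ
  chainBound n K = K + (n + (n + n) + K * suc (2 * (K * K * K)))

  length-convexChain≤ : ∀ {n} K cs → Linked _<ₓ_ cs → All (InBox n) cs → Linked _≺_ (steps cs) →
                        K * length cs ≤ chainBound n K
  length-convexChain≤ K [] _ _ _ = ≤-trans (≤-reflexive (*-zeroʳ K)) z≤n
  length-convexChain≤ {n} K (p ∷ cs) increasing inBox@((_ , y≤n) ∷ _) convex = begin
    K * length (p ∷ cs)       ≤⟨ *-monoʳ-≤ K (length≤suc-steps (p ∷ cs)) ⟩
    K * suc (length V)        ≡⟨ *-suc K _ ⟩
    K + K * length V          ≤⟨ +-monoʳ-≤ K (length-increasingSlopes≤ V slopes-increasing) ⟩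
    K + (R + A + K * suc M)   ≤⟨ +-monoʳ-≤ K (+-monoˡ-≤ (K * suc M) (+-mono-≤ R≤n A≤2n)) ⟩
    chainBound n K            ∎
    where
    open ≤-Reasoning
    open SlopeCount K using (length-increasingSlopes≤)
    V = steps (p ∷ cs)
    R = totalRun V
    A = totalRise V
    M = 2 * (K * K * K)
    slopes-increasing : AllPairs _≺_ V
    slopes-increasing = Linked⇒AllPairs (λ {u} {v} {w} → ≺-trans {u} {v} {w}) convex
    R≤n : R ≤ n
    R≤n = ≤-trans (m≤m+n R (X p)) (total-run≤ p cs increasing inBox)
    A≤2n : A ≤ n + n
    A≤2n = ≤-trans (total-rise≤ p cs convex inBox) (+-monoˡ-≤ n y≤n)

module IntegerHull where
  open IntegerFacts
  open Chains using (X; Y; _<ₓ_)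
  open import Data.Integer hiding (suc)
  open import Data.Integer.Properties using (<⇒≤; <⇒≢; neg-mono-<; neg-mono-≤; ≮⇒≥; +-identityʳ; _<?_)
  import Data.Integer.Tactic.RingSolver as Ring
  import Data.Nat as ℕ
  import Data.Nat.Properties as ℕ
  open import Data.Empty using (⊥-elim)
  open import Data.List.Membership.Propositional using (_∈_)

  x y : Point → ℤ
  x p = + X p
  y p = + Y p

  weightSumℤ xSumℤ ySumℤ : List (ℤ × Point) → ℤ
  weightSumℤ [] = 0ℤ
  weightSumℤ ((w , _) ∷ ws) = w + weightSumℤ ws
  xSumℤ [] = 0ℤ
  xSumℤ ((w , q) ∷ ws) = w * x q + xSumℤ ws
  ySumℤ [] = 0ℤ
  ySumℤ ((w , q) ∷ ws) = w * y q + ySumℤ ws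

  Admissible : List Point → Point → ℤ × Point → Set
  Admissible S p (w , q) = 0ℤ ≤ w × q ∈ S × q ≢ p

  -- InHullOfOthers with the denominators cleared: total weight W > 0 instead of 1.
  IntHullOfOthers : List Point → Point → Set
  IntHullOfOthers S p = ∃ λ ws → All (Admissible S p) ws × ∃ λ W →
    0ℤ < W × weightSumℤ ws ≡ W × xSumℤ ws ≡ W * x p × ySumℤ ws ≡ W * y p

  -- (X r − X q) times the height of the segment qr above p.
  offset : Point → Point → Point → ℤ
  offset q r p = (x r - x p) * y q + (x p - x q) * y r - (x r - x q) * y p

  offset-left : ∀ q r → offset q r q ≡ 0ℤ
  offset-left q r = vanish (x q) (y q) (x r) (y r)
    where
    vanish : ∀ xq yq xr yr → (xr - xq) * yq + (xq - xq) * yr - (xr - xq) * yq ≡ 0ℤ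
    vanish = Ring.solve-∀

  offset-right : ∀ q r → offset q r r ≡ 0ℤ
  offset-right q r = vanish (x q) (y q) (x r) (y r)
    where
    vanish : ∀ xq yq xr yr → (xr - xr) * yq + (xr - xq) * yr - (xr - xq) * yr ≡ 0ℤ
    vanish = Ring.solve-∀

  record Straddle (S : List Point) (p q r : Point) : Set where
    field
      left∈ : q ∈ S
      right∈ : r ∈ S
      left≢ : q ≢ p
      right≢ : r ≢ p
      left≤ : X q ℕ.≤ X p
      ≤right : X p ℕ.≤ X r

  <ₓ⇒≢ : ∀ {p q} → p <ₓ q → p ≢ q
  <ₓ⇒≢ p<q refl = ℕ.<-irrefl refl p<q

  straddle : ∀ {S p q r} → q ∈ S → r ∈ S → q <ₓ p → p <ₓ r → Straddle S p q r
  straddle q∈ r∈ q<p p<r = record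
    { left∈ = q∈ ; right∈ = r∈ ; left≢ = <ₓ⇒≢ q<p ; right≢ = ≢-sym (<ₓ⇒≢ p<r)
    ; left≤ = ℕ.<⇒≤ q<p ; ≤right = ℕ.<⇒≤ p<r }

  -- (X r − X p)·q + (X p − X q)·r is (X r − X q)·p moved vertically by offset q r p; weighting
  -- two such pairs so that the vertical moves cancel exhibits p in the hull of q, r, q′, r′.
  mix : ∀ {S p q r q′ r′} → Straddle S p q r → Straddle S p q′ r′ → ∀ c d → 0ℤ ≤ c → 0ℤ ≤ d →
        c * offset q r p + d * offset q′ r′ p ≡ 0ℤ → 0ℤ < c * (x r - x q) + d * (x r′ - x q′) →
        IntHullOfOthers S p
  mix {S} {p} {q} {r} {q′} {r′} s s′ c d c≥0 d≥0 balanced W>0 =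
    ws , admissible , W , W>0 , weightSum-ws , xSum-ws , ySum-ws
    where
    module s = Straddle s
    module s′ = Straddle s′
    W = c * (x r - x q) + d * (x r′ - x q′)
    ws : List (ℤ × Point)
    ws = (c * (x r - x p) , q) ∷ (c * (x p - x q) , r) ∷ (d * (x r′ - x p) , q′) ∷ (d * (x p - x q′) , r′) ∷ []
    admissible : All (Admissible S p) ws
    admissible = (0≤* c≥0 (0≤+-+ s.≤right) , s.left∈ , s.left≢)
               ∷ (0≤* c≥0 (0≤+-+ s.left≤) , s.right∈ , s.right≢)
               ∷ (0≤* d≥0 (0≤+-+ s′.≤right) , s′.left∈ , s′.left≢)
               ∷ (0≤* d≥0 (0≤+-+ s′.left≤) , s′.right∈ , s′.right≢) ∷ []
    weightSum-ws : weightSumℤ ws ≡ W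
    weightSum-ws = identity c d (x p) (x q) (x r) (x q′) (x r′)
      where
      identity : ∀ c d p q r q′ r′ →
        c * (r - p) + (c * (p - q) + (d * (r′ - p) + (d * (p - q′) + 0ℤ))) ≡ c * (r - q) + d * (r′ - q′)
      identity = Ring.solve-∀
    xSum-ws : xSumℤ ws ≡ W * x p
    xSum-ws = identity c d (x p) (x q) (x r) (x q′) (x r′)
      where
      identity : ∀ c d p q r q′ r′ →
        c * (r - p) * q + (c * (p - q) * r + (d * (r′ - p) * q′ + (d * (p - q′) * r′ + 0ℤ))) ≡ (c * (r - q) + d * (r′ - q′)) * p
      identity = Ring.solve-∀
    ySum-ws : ySumℤ ws ≡ W * y p
    ySum-ws = begin
      ySumℤ ws
        ≡⟨ identity c d (x p) (y p) (x q) (y q) (x r) (y r) (x q′) (y q′) (x r′) (y r′) ⟩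
      W * y p + (c * offset q r p + d * offset q′ r′ p)   ≡⟨ cong (λ t → W * y p + t) balanced ⟩
      W * y p + 0ℤ                                        ≡⟨ +-identityʳ (W * y p) ⟩
      W * y p                                             ∎
      where
      open ≡-Reasoning
      identity : ∀ c d xp yp xq yq xr yr xq′ yq′ xr′ yr′ →
        c * (xr - xp) * yq + (c * (xp - xq) * yr + (d * (xr′ - xp) * yq′ + (d * (xp - xq′) * yr′ + 0ℤ)))
        ≡ (c * (xr - xq) + d * (xr′ - xq′)) * yp
          + (c * ((xr - xp) * yq + (xp - xq) * yr - (xr - xq) * yp) + d * ((xr′ - xp) * yq′ + (xp - xq′) * yr′ - (xr′ - xq′) * yp))
      identity = Ring.solve-∀

  module Chord {S : List Point} {A B : Point} (A∈S : A ∈ S) (B∈S : B ∈ S) where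

    chordStraddle : ∀ {p} → X A ℕ.≤ X p → X p ℕ.≤ X B → offset A B p ≢ 0ℤ → Straddle S p A B
    chordStraddle {p} A≤p p≤B off≢0 = record
      { left∈ = A∈S ; right∈ = B∈S
      ; left≢ = λ { refl → off≢0 (offset-left A B) } ; right≢ = λ { refl → off≢0 (offset-right A B) }
      ; left≤ = A≤p ; ≤right = p≤B }

    below-chord-turn : ∀ {a p c} → X A ℕ.≤ X p → X p ℕ.≤ X B → 0ℤ < offset A B p →
                       a ∈ S → c ∈ S → a <ₓ p → p <ₓ c → ¬ IntHullOfOthers S p → 0ℤ < offset a c p
    below-chord-turn {a} {p} {c} A≤p p≤B below a∈ c∈ a<p p<c extreme with 0ℤ <? offset a c p
    ... | yes turn = turn
    ... | no ¬turn = ⊥-elim (extreme (mix (straddle a∈ c∈ a<p p<c) (chordStraddle A≤p p≤B (≢-sym (<⇒≢ below)))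
                                          (offset A B p) (- offset a c p) (<⇒≤ below) d≥0 balanced W>0))
      where
      d≥0 : 0ℤ ≤ - offset a c p
      d≥0 = neg-mono-≤ (≮⇒≥ ¬turn)
      balanced : offset A B p * offset a c p + - offset a c p * offset A B p ≡ 0ℤ
      balanced = cancel (offset A B p) (offset a c p)
        where
        cancel : ∀ u v → u * v + - v * u ≡ 0ℤ
        cancel = Ring.solve-∀
      W>0 : 0ℤ < offset A B p * (x c - x a) + - offset a c p * (x B - x A)
      W>0 = 0<+0≤ (0<* below (0<+-+ (ℕ.<-trans a<p p<c))) (0≤* d≥0 (0≤+-+ (ℕ.≤-trans A≤p p≤B)))

    above-chord-turn : ∀ {a p c} → X A ℕ.≤ X p → X p ℕ.≤ X B → offset A B p < 0ℤ →
                       a ∈ S → c ∈ S → a <ₓ p → p <ₓ c → ¬ IntHullOfOthers S p → offset a c p < 0ℤ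
    above-chord-turn {a} {p} {c} A≤p p≤B above a∈ c∈ a<p p<c extreme with offset a c p <? 0ℤ
    ... | yes turn = turn
    ... | no ¬turn = ⊥-elim (extreme (mix (straddle a∈ c∈ a<p p<c) (chordStraddle A≤p p≤B (<⇒≢ above))
                                          (- offset A B p) (offset a c p) (<⇒≤ c>0) d≥0 balanced W>0))
      where
      c>0 : 0ℤ < - offset A B p
      c>0 = neg-mono-< above
      d≥0 : 0ℤ ≤ offset a c p
      d≥0 = ≮⇒≥ ¬turn
      balanced : - offset A B p * offset a c p + offset a c p * offset A B p ≡ 0ℤ
      balanced = cancel (offset A B p) (offset a c p)
        where
        cancel : ∀ u v → - u * v + v * u ≡ 0ℤ
        cancel = Ring.solve-∀
      W>0 : 0ℤ < - offset A B p * (x c - x a) + offset a c p * (x B - x A)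
      W>0 = 0<+0≤ (0<* c>0 (0<+-+ (ℕ.<-trans a<p p<c))) (0≤* d≥0 (0≤+-+ (ℕ.≤-trans A≤p p≤B)))

    on-chord : ∀ {p} → A <ₓ p → p <ₓ B → offset A B p ≡ 0ℤ → IntHullOfOthers S p
    on-chord A<p p<B on = mix s s (+ 1) 0ℤ (+≤+ z≤n) (+≤+ z≤n) (cong (λ t → + 1 * t + 0ℤ * t) on)
      (0<+0≤ {j = 0ℤ * (x B - x A)} (0<* {+ 1} (+<+ (s≤s z≤n)) (0<+-+ A<B)) (0≤* {0ℤ} (+≤+ z≤n) (0≤+-+ (ℕ.<⇒≤ A<B))))
      where
      s = straddle A∈S B∈S A<p p<B
      A<B = ℕ.<-trans A<p p<B

module StepTurns where
  open SlopeOrder using (run; rise; cross)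
  open Chains using (X; Y; _<ₓ_; step)
  open IntegerHull using (x; y; offset)
  open IntegerFacts using (+-+≡+∸)
  open import Data.Integer hiding (suc)
  open import Data.Integer.Properties using (m-n≡m⊖n)
  import Data.Integer.Tactic.RingSolver as Ring
  import Data.Nat as ℕ
  import Data.Nat.Properties as ℕ

  run-step : ∀ {p q} → p <ₓ q → + run (step p q) ≡ x q - x p
  run-step {p} {q} p<q = trans (cong +_ (sym (ℕ.+-∸-assoc 1 p<q))) (sym (+-+≡+∸ (ℕ.<⇒≤ p<q)))

  rise-step : ∀ p q → rise (step p q) ≡ y q - y p
  rise-step p q = sym (m-n≡m⊖n (Y q) (Y p))

  cross-steps : ∀ {a p c} → a <ₓ p → p <ₓ c → cross (step a p) (step p c) ≡ offset a c p
  cross-steps {a} {p} {c} a<p p<c = begin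
    + run (step a p) * rise (step p c) - rise (step a p) * + run (step p c)
      ≡⟨ cong₂ (λ s t → s * rise (step p c) - rise (step a p) * t) (run-step {a} {p} a<p) (run-step {p} {c} p<c) ⟩
    (x p - x a) * rise (step p c) - rise (step a p) * (x c - x p)
      ≡⟨ cong₂ (λ s t → (x p - x a) * s - t * (x c - x p)) (rise-step p c) (rise-step a p) ⟩
    (x p - x a) * (y c - y p) - (y p - y a) * (x c - x p)
      ≡⟨ expand (x a) (y a) (x p) (y p) (x c) (y c) ⟩
    offset a c p ∎
    where
    open ≡-Reasoning
    expand : ∀ xa ya xp yp xc yc → (xp - xa) * (yc - yp) - (yp - ya) * (xc - xp) ≡ (xc - xp) * ya + (xp - xa) * yc - (xc - xa) * yp
    expand = Ring.solve-∀

  flip : ℕ → Point → Point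
  flip n q = (X q , n ℕ.∸ Y q)

  offset-flip : ∀ {n a c p} → Y a ℕ.≤ n → Y c ℕ.≤ n → Y p ℕ.≤ n →
                offset (flip n a) (flip n c) (flip n p) ≡ - offset a c p
  offset-flip {n} {a} {c} {p} a≤n c≤n p≤n = begin
    offset (flip n a) (flip n c) (flip n p)
      ≡⟨ cong₃ (λ s t u → (x c - x p) * s + (x p - x a) * t - (x c - x a) * u)
               (sym (+-+≡+∸ a≤n)) (sym (+-+≡+∸ c≤n)) (sym (+-+≡+∸ p≤n)) ⟩
    (x c - x p) * (+ n - y a) + (x p - x a) * (+ n - y c) - (x c - x a) * (+ n - y p)
      ≡⟨ negate (+ n) (x a) (y a) (x p) (y p) (x c) (y c) ⟩
    - offset a c p ∎
    where
    open ≡-Reasoning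
    cong₃ : ∀ (f : ℤ → ℤ → ℤ → ℤ) {s s′ t t′ u u′} → s ≡ s′ → t ≡ t′ → u ≡ u′ → f s t u ≡ f s′ t′ u′
    cong₃ f refl refl refl = refl
    negate : ∀ N xa ya xp yp xc yc → (xc - xp) * (N - ya) + (xp - xa) * (N - yc) - (xc - xa) * (N - yp)
             ≡ - ((xc - xp) * ya + (xp - xa) * yc - (xc - xa) * yp)
    negate = Ring.solve-∀

module SortByX where
  open Chains using (X; _<ₓ_)
  open import Data.Nat using (_≤_)
  open import Data.Nat.Properties using (≤-decTotalOrder; ≤-trans; ≤∧≢⇒<)
  import Relation.Binary.Construct.On as On
  open import Data.List.Sort (On.decTotalOrder ≤-decTotalOrder X) public using (sort; sort-↭; sort-↗)
  open import Data.List.Relation.Binary.Permutation.Propositional using (↭-sym; ↭⇒↭ₛ)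
  open import Data.List.Relation.Binary.Permutation.Propositional.Properties using (∈-resp-↭; ↭-length)
  open import Data.List.Relation.Binary.Permutation.Setoid.Properties (setoid Point) using (AllPairs-resp-↭)
  open import Data.List.Relation.Unary.Linked.Properties using (Linked⇒AllPairs)
  open import Data.List.Membership.Propositional using (_∈_)
  import Data.List.Relation.Unary.AllPairs as AllPairs
  open import Function using (_∘_)

  DistinctX : Point → Point → Set
  DistinctX p q = X p ≢ X q

  sort-increasing : ∀ S → AllPairs DistinctX S → AllPairs _<ₓ_ (sort S)
  sort-increasing S distinct = AllPairs.zipWith (λ (≤ₓ , ≢ₓ) → ≤∧≢⇒< ≤ₓ ≢ₓ) (sorted , distinct′)
    where
    sorted : AllPairs (λ p q → X p ≤ X q) (sort S)
    sorted = Linked⇒AllPairs ≤-trans (sort-↗ S)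
    distinct′ : AllPairs DistinctX (sort S)
    distinct′ = AllPairs-resp-↭ (λ ne → ne ∘ sym) (resp₂ DistinctX) (↭⇒↭ₛ (↭-sym (sort-↭ S))) distinct

  sort-⊆ : ∀ S {p} → p ∈ sort S → p ∈ S
  sort-⊆ S = ∈-resp-↭ (sort-↭ S)

  length-sort : ∀ S → length (sort S) ≡ length S
  length-sort S = ↭-length (sort-↭ S)

module ConvexPositionCount where
  open SlopeOrder using (_≺_)
  open Chains
  open IntegerHull
  open StepTurns using (cross-steps; flip; offset-flip)
  open SortByX
  open import Data.Nat
  open import Data.Nat.Properties
  open import Data.Integer as ℤ using (0ℤ)
  import Data.Integer.Properties as ℤP
  open import Data.Empty using (⊥-elim)
  open import Data.Sum using ([_,_]′)
  open import Function using (_∘_)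
  open import Data.List.Properties using (length-map)
  open import Data.List.Membership.Propositional using (_∈_)
  open import Data.List.Relation.Unary.Any using (here; there)
  open import Data.List.Extrema.Nat
    using (argmin; argmax; argmin-sel; argmax-sel; f[argmin]≤f[⊤]; f[argmin]≤f[xs]; f[⊥]≤f[argmax]; f[xs]≤f[argmax])
  import Data.List.Relation.Unary.All.Properties as AllP
  import Data.List.Relation.Unary.AllPairs.Properties as AllPairsP
  import Data.List.Relation.Unary.Linked.Properties as LinkedP
  open import Relation.Nullary using (¬?)
  open import Relation.Unary using (Decidable)

  record ConvexPosition (n : ℕ) (S : List Point) : Set where
    field
      inBox : All (InBox n) S
      distinctX : AllPairs DistinctX S
      extreme : ∀ {p} → p ∈ S → ¬ IntHullOfOthers S p

  length-filter-split : ∀ {P : Point → Set} (P? : Decidable P) xs →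
                        length xs ≡ length (filter P? xs) + length (filter (¬? ∘ P?) xs)
  length-filter-split P? [] = refl
  length-filter-split P? (x ∷ xs) with P? x
  ... | yes _ = cong suc (length-filter-split P? xs)
  ... | no _ = trans (cong suc (length-filter-split P? xs)) (sym (+-suc _ _))

  graph : (Point → ℕ) → Point → Point
  graph h q = (X q , h q)

  length-graphChain≤ : ∀ {n} K (h : Point → ℕ) (Q : Point → Set) cs → AllPairs _<ₓ_ cs → All Q cs →
    All (λ z → X z ≤ n × h z ≤ n) cs →
    (∀ {a p c} → Q a → Q p → Q c → a <ₓ p → p <ₓ c → 0ℤ ℤ.< offset (graph h a) (graph h c) (graph h p)) →
    K * length cs ≤ chainBound n K
  length-graphChain≤ K h Q cs increasing qs inBox turns =
    subst (λ m → K * m ≤ _) (length-map (graph h) cs)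
      (length-convexChain≤ K (map (graph h) cs) (LinkedP.map⁺ (LinkedP.AllPairs⇒Linked increasing)) (AllP.map⁺ inBox)
        (convex cs (LinkedP.AllPairs⇒Linked increasing) qs))
    where
    convex : ∀ cs → Linked _<ₓ_ cs → All Q cs → Linked _≺_ (steps (map (graph h) cs))
    convex [] _ _ = []
    convex (_ ∷ []) _ _ = []
    convex (_ ∷ _ ∷ []) _ _ = [-]
    convex (a ∷ p ∷ c ∷ cs) (a<p ∷ p<c ∷ lk) (qa ∷ qp ∷ qc ∷ qs) =
      subst (0ℤ ℤ.<_) (sym (cross-steps {graph h a} {graph h p} {graph h c} a<p p<c)) (turns qa qp qc a<p p<c)
      ∷ convex (p ∷ c ∷ cs) (p<c ∷ lk) (qp ∷ qc ∷ qs)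

  module _ {n : ℕ} {S : List Point} (cp : ConvexPosition n S) {A B : Point} (A∈S : A ∈ S) (B∈S : B ∈ S)
           (leftmost : ∀ {z} → z ∈ S → X A ≤ X z) (rightmost : ∀ {z} → z ∈ S → X z ≤ X B) where
    open ConvexPosition cp
    open Chord A∈S B∈S

    Below Above : Point → Set
    Below z = 0ℤ ℤ.< offset A B z
    Above z = offset A B z ℤ.< 0ℤ

    below? : Decidable Below
    below? z = 0ℤ ℤP.<? offset A B z

    above? : Decidable Above
    above? z = offset A B z ℤP.<? 0ℤ

    Y≤n : ∀ {z} → z ∈ S → Y z ≤ n
    Y≤n z∈ = proj₂ (All.lookup inBox z∈)

    below-count : ∀ K cs → AllPairs _<ₓ_ cs → All (_∈ S) cs → K * length (filter below? cs) ≤ chainBound n K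
    below-count K cs increasing ⊆S =
      length-graphChain≤ K Y (λ z → z ∈ S × Below z) (filter below? cs) (AllPairsP.filter⁺ below? increasing)
        members (All.map (λ (z∈ , _) → All.lookup inBox z∈) members) turn
      where
      members : All (λ z → z ∈ S × Below z) (filter below? cs)
      members = All.zip (AllP.filter⁺ below? ⊆S , AllP.all-filter below? cs)
      turn : ∀ {a p c} → a ∈ S × Below a → p ∈ S × Below p → c ∈ S × Below c → a <ₓ p → p <ₓ c →
             0ℤ ℤ.< offset a c p
      turn (a∈ , _) (p∈ , below) (c∈ , _) a<p p<c =
        below-chord-turn (leftmost p∈) (rightmost p∈) below a∈ c∈ a<p p<c (extreme p∈)

    above-count : ∀ K cs → AllPairs _<ₓ_ cs → All (_∈ S) cs → K * length (filter above? cs) ≤ chainBound n K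
    above-count K cs increasing ⊆S =
      length-graphChain≤ K (λ z → n ∸ Y z) (λ z → z ∈ S × Above z) (filter above? cs) (AllPairsP.filter⁺ above? increasing)
        members (All.map (λ {z} (z∈ , _) → proj₁ (All.lookup inBox z∈) , m∸n≤m n (Y z)) members) turn
      where
      members : All (λ z → z ∈ S × Above z) (filter above? cs)
      members = All.zip (AllP.filter⁺ above? ⊆S , AllP.all-filter above? cs)
      turn : ∀ {a p c} → a ∈ S × Above a → p ∈ S × Above p → c ∈ S × Above c → a <ₓ p → p <ₓ c →
             0ℤ ℤ.< offset (flip n a) (flip n c) (flip n p)
      turn {a} {p} {c} (a∈ , _) (p∈ , above) (c∈ , _) a<p p<c =
        subst (0ℤ ℤ.<_) (sym (offset-flip {n} {a} {c} {p} (Y≤n a∈) (Y≤n c∈) (Y≤n p∈)))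
          (ℤP.neg-mono-< (above-chord-turn (leftmost p∈) (rightmost p∈) above a∈ c∈ a<p p<c (extreme p∈)))

    on-count : ∀ cs → AllPairs _<ₓ_ cs → All (λ z → z ∈ S × offset A B z ≡ 0ℤ) cs → length cs ≤ 2
    on-count [] _ _ = z≤n
    on-count (_ ∷ []) _ _ = s≤s z≤n
    on-count (_ ∷ _ ∷ []) _ _ = s≤s (s≤s z≤n)
    on-count (_ ∷ _ ∷ _ ∷ _) ((z₁<z₂ ∷ _) ∷ (z₂<z₃ ∷ _) ∷ _) ((z₁∈ , _) ∷ (z₂∈ , on) ∷ (z₃∈ , _) ∷ _) =
      ⊥-elim (extreme z₂∈ (on-chord (≤-<-trans (leftmost z₁∈) z₁<z₂) (<-≤-trans z₂<z₃ (rightmost z₃∈)) on))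

    length-sortedPosition≤ : ∀ K cs → AllPairs _<ₓ_ cs → All (_∈ S) cs →
                             K * length cs ≤ chainBound n K + (chainBound n K + K * 2)
    length-sortedPosition≤ K cs increasing ⊆S = begin
      K * length cs
        ≡⟨ cong (K *_) (trans (length-filter-split below? cs) (cong (length lower +_) (length-filter-split above? rest))) ⟩
      K * (length lower + (length upper + length on))
        ≡⟨ trans (*-distribˡ-+ K (length lower) _) (cong (K * length lower +_) (*-distribˡ-+ K (length upper) _)) ⟩
      K * length lower + (K * length upper + K * length on)
        ≤⟨ +-mono-≤ (below-count K cs increasing ⊆S)
                    (+-mono-≤ (above-count K rest (AllPairsP.filter⁺ _ increasing) (AllP.filter⁺ _ ⊆S))
                              (*-monoʳ-≤ K (on-count on (AllPairsP.filter⁺ _ (AllPairsP.filter⁺ _ increasing)) on-members))) ⟩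
      chainBound n K + (chainBound n K + K * 2) ∎
      where
      open ≤-Reasoning
      lower = filter below? cs
      rest = filter (¬? ∘ below?) cs
      upper = filter above? rest
      on = filter (¬? ∘ above?) rest
      on-members : All (λ z → z ∈ S × offset A B z ≡ 0ℤ) on
      on-members = All.zipWith (λ ((z∈ , ¬below) , ¬above) → z∈ , ℤP.≤-antisym (ℤP.≮⇒≥ ¬below) (ℤP.≮⇒≥ ¬above))
        (All.zip (AllP.filter⁺ _ (AllP.filter⁺ _ ⊆S) , AllP.filter⁺ _ (AllP.all-filter _ cs)) , AllP.all-filter _ rest)

  length-convexPosition≤ : ∀ {n} K S → ConvexPosition n S → K * length S ≤ chainBound n K + (chainBound n K + K * 2)
  length-convexPosition≤ K [] _ = ≤-trans (≤-reflexive (*-zeroʳ K)) z≤n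
  length-convexPosition≤ K S@(s ∷ ss) cp =
    subst (λ m → K * m ≤ _) (length-sort S)
      (length-sortedPosition≤ cp A∈S B∈S leftmost rightmost K (sort S)
        (sort-increasing S (ConvexPosition.distinctX cp)) (All.tabulate (sort-⊆ S)))
    where
    A = argmin X s ss
    B = argmax X s ss
    A∈S : A ∈ S
    A∈S = [ here , there ]′ (argmin-sel X s ss)
    B∈S : B ∈ S
    B∈S = [ here , there ]′ (argmax-sel X s ss)
    leftmost : ∀ {z} → z ∈ S → X A ≤ X z
    leftmost = All.lookup (f[argmin]≤f[⊤] {f = X} s ss ∷ f[argmin]≤f[xs] {f = X} s ss)
    rightmost : ∀ {z} → z ∈ S → X z ≤ X B
    rightmost = All.lookup (f[⊥]≤f[argmax] {f = X} s ss ∷ f[xs]≤f[argmax] {f = X} s ss)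

module RationalHull where
  open IntegerHull
  open import Data.Integer as ℤ using (ℤ; +_)
  open import Data.Rational as ℚ using (ℚ; 0ℚ; 1ℚ; toℚᵘ; 1/_)
  import Data.Rational.Properties as ℚP
  open import Data.Rational.Unnormalised as ℚᵘ using (mkℚᵘ; *≡*)
  import Data.Rational.Unnormalised.Properties as ℚᵘP
  import Data.Integer.Tactic.RingSolver as Ring
  open import Data.List.Membership.Propositional using (_∈_)

  ι : ℤ → ℚ
  ι z = z ℚ./ 1

  ι≃ : ∀ z → toℚᵘ (ι z) ℚᵘ.≃ mkℚᵘ z 0
  ι≃ z = ℚP.toℚᵘ-fromℚᵘ (mkℚᵘ z 0)

  ι-+ : ∀ a b → ι (a ℤ.+ b) ≡ ι a ℚ.+ ι b
  ι-+ a b = ℚP.toℚᵘ-injective (begin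
    toℚᵘ (ι (a ℤ.+ b))                      ≈⟨ ι≃ (a ℤ.+ b) ⟩
    mkℚᵘ (a ℤ.+ b) 0                        ≈⟨ *≡* (identity a b) ⟩
    mkℚᵘ a 0 ℚᵘ.+ mkℚᵘ b 0                  ≈⟨ ℚᵘP.+-cong (ι≃ a) (ι≃ b) ⟨
    toℚᵘ (ι a) ℚᵘ.+ toℚᵘ (ι b)              ≈⟨ ℚP.toℚᵘ-homo-+ (ι a) (ι b) ⟨
    toℚᵘ (ι a ℚ.+ ι b)                      ∎)
    where
    open ℚᵘP.≃-Reasoning
    identity : ∀ a b → (a ℤ.+ b) ℤ.* + 1 ≡ (a ℤ.* + 1 ℤ.+ b ℤ.* + 1) ℤ.* + 1
    identity = Ring.solve-∀

  ι-* : ∀ a b → ι (a ℤ.* b) ≡ ι a ℚ.* ι b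
  ι-* a b = ℚP.toℚᵘ-injective (begin
    toℚᵘ (ι (a ℤ.* b))                      ≈⟨ ι≃ (a ℤ.* b) ⟩
    mkℚᵘ a 0 ℚᵘ.* mkℚᵘ b 0                  ≈⟨ ℚᵘP.*-cong (ι≃ a) (ι≃ b) ⟨
    toℚᵘ (ι a) ℚᵘ.* toℚᵘ (ι b)              ≈⟨ ℚP.toℚᵘ-homo-* (ι a) (ι b) ⟨
    toℚᵘ (ι a ℚ.* ι b)                      ∎)
    where
    open ℚᵘP.≃-Reasoning

  scale : ℚ → List (ℤ × Point) → List (ℚ × Point)
  scale r [] = []
  scale r ((w , q) ∷ ws) = (ι w ℚ.* r , q) ∷ scale r ws

  weightSum-scale : ∀ r ws → weightSum (scale r ws) ≡ ι (weightSumℤ ws) ℚ.* r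
  weightSum-scale r [] = sym (ℚP.*-zeroˡ r)
  weightSum-scale r ((w , q) ∷ ws) = begin
    ι w ℚ.* r ℚ.+ weightSum (scale r ws)          ≡⟨ cong (ι w ℚ.* r ℚ.+_) (weightSum-scale r ws) ⟩
    ι w ℚ.* r ℚ.+ ι (weightSumℤ ws) ℚ.* r         ≡⟨ ℚP.*-distribʳ-+ r (ι w) (ι (weightSumℤ ws)) ⟨
    (ι w ℚ.+ ι (weightSumℤ ws)) ℚ.* r             ≡⟨ cong (ℚ._* r) (ι-+ w (weightSumℤ ws)) ⟨
    ι (w ℤ.+ weightSumℤ ws) ℚ.* r                 ∎
    where open ≡-Reasoning

  moment-step : ∀ w r z s → ι w ℚ.* r ℚ.* ι z ℚ.+ s ℚ.* r ≡ ι (w ℤ.* z) ℚ.* r ℚ.+ s ℚ.* r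
  moment-step w r z s = cong (ℚ._+ s ℚ.* r) (begin
    ι w ℚ.* r ℚ.* ι z      ≡⟨ ℚP.*-assoc (ι w) r (ι z) ⟩
    ι w ℚ.* (r ℚ.* ι z)    ≡⟨ cong (ι w ℚ.*_) (ℚP.*-comm r (ι z)) ⟩
    ι w ℚ.* (ι z ℚ.* r)    ≡⟨ ℚP.*-assoc (ι w) (ι z) r ⟨
    ι w ℚ.* ι z ℚ.* r      ≡⟨ cong (ℚ._* r) (ι-* w z) ⟨
    ι (w ℤ.* z) ℚ.* r      ∎)
    where open ≡-Reasoning

  xSum-scale : ∀ r ws → xSum (scale r ws) ≡ ι (xSumℤ ws) ℚ.* r
  xSum-scale r [] = sym (ℚP.*-zeroˡ r)
  xSum-scale r ((w , q) ∷ ws) = begin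
    ι w ℚ.* r ℚ.* ι (x q) ℚ.+ xSum (scale r ws)   ≡⟨ cong (ι w ℚ.* r ℚ.* ι (x q) ℚ.+_) (xSum-scale r ws) ⟩
    ι w ℚ.* r ℚ.* ι (x q) ℚ.+ ι (xSumℤ ws) ℚ.* r  ≡⟨ moment-step w r (x q) (ι (xSumℤ ws)) ⟩
    ι (w ℤ.* x q) ℚ.* r ℚ.+ ι (xSumℤ ws) ℚ.* r    ≡⟨ ℚP.*-distribʳ-+ r (ι (w ℤ.* x q)) (ι (xSumℤ ws)) ⟨
    (ι (w ℤ.* x q) ℚ.+ ι (xSumℤ ws)) ℚ.* r        ≡⟨ cong (ℚ._* r) (ι-+ (w ℤ.* x q) (xSumℤ ws)) ⟨
    ι (w ℤ.* x q ℤ.+ xSumℤ ws) ℚ.* r              ∎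
    where open ≡-Reasoning

  ySum-scale : ∀ r ws → ySum (scale r ws) ≡ ι (ySumℤ ws) ℚ.* r
  ySum-scale r [] = sym (ℚP.*-zeroˡ r)
  ySum-scale r ((w , q) ∷ ws) = begin
    ι w ℚ.* r ℚ.* ι (y q) ℚ.+ ySum (scale r ws)   ≡⟨ cong (ι w ℚ.* r ℚ.* ι (y q) ℚ.+_) (ySum-scale r ws) ⟩
    ι w ℚ.* r ℚ.* ι (y q) ℚ.+ ι (ySumℤ ws) ℚ.* r  ≡⟨ moment-step w r (y q) (ι (ySumℤ ws)) ⟩
    ι (w ℤ.* y q) ℚ.* r ℚ.+ ι (ySumℤ ws) ℚ.* r    ≡⟨ ℚP.*-distribʳ-+ r (ι (w ℤ.* y q)) (ι (ySumℤ ws)) ⟨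
    (ι (w ℤ.* y q) ℚ.+ ι (ySumℤ ws)) ℚ.* r        ≡⟨ cong (ℚ._* r) (ι-+ (w ℤ.* y q) (ySumℤ ws)) ⟨
    ι (w ℤ.* y q ℤ.+ ySumℤ ws) ℚ.* r              ∎
    where open ≡-Reasoning

  intHull⇒hull : ∀ {n S p} → (∀ {q} → q ∈ S → InG n q) → IntHullOfOthers S p → InHullOfOthers n p
  intHull⇒hull {n} {S} {p} ⊆G (ws , admissible , _ , ℤ.+<+ {n = suc k} _ , weights , xs , ys) =
    scale r ws , weights-ok ws admissible ,
    trans (weightSum-scale r ws) (trans (cong (λ t → ι t ℚ.* r) weights) (ℚP.*-inverseʳ W)) ,
    trans (xSum-scale r ws) (trans (cong (λ t → ι t ℚ.* r) xs) (cancel (x p))) ,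
    trans (ySum-scale r ws) (trans (cong (λ t → ι t ℚ.* r) ys) (cancel (y p)))
    where
    W = ι (+ suc k)
    instance
      W-pos : ℚ.Positive W
      W-pos = ℚP.normalize-pos (suc k) 1
      W≢0 : ℚ.NonZero W
      W≢0 = ℚP.pos⇒nonZero W
    r = 1/ W
    r≥0 : ℚ.NonNegative r
    r≥0 = ℚP.pos⇒nonNeg r {{ℚP.1/pos⇒pos W}}
    weights-ok : ∀ ws → All (Admissible S p) ws → All (λ { (w , q) → (0ℚ ℚ.≤ w) × InG n q × (q ≢ p) }) (scale r ws)
    weights-ok [] [] = []
    weights-ok ((+ m , q) ∷ ws) ((_ , q∈ , q≢p) ∷ rest) =
      (ℚP.nonNegative⁻¹ _ {{ℚP.nonNeg*nonNeg⇒nonNeg (ι (+ m)) {{ℚP.normalize-nonNeg m 1}} r {{r≥0}}}} , ⊆G q∈ , q≢p)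
      ∷ weights-ok ws rest
    cancel : ∀ z → ι (+ suc k ℤ.* z) ℚ.* r ≡ ι z
    cancel z = begin
      ι (+ suc k ℤ.* z) ℚ.* r   ≡⟨ cong (ℚ._* r) (trans (ι-* (+ suc k) z) (ℚP.*-comm W (ι z))) ⟩
      ι z ℚ.* W ℚ.* r             ≡⟨ ℚP.*-assoc (ι z) W r ⟩
      ι z ℚ.* (W ℚ.* r)           ≡⟨ cong (ι z ℚ.*_) (ℚP.*-inverseʳ W) ⟩
      ι z ℚ.* 1ℚ                  ≡⟨ ℚP.*-identityʳ (ι z) ⟩
      ι z                         ∎
      where open ≡-Reasoning

module ModularInverse where
  open import Data.Nat
  open import Data.Nat.Properties
  open import Data.Nat.Divisibility
  open import Data.Nat.Coprimality using (Coprime; coprime-divisor)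
  open import Data.Sum using (inj₁; inj₂)

  ∣-<⇒≡0 : ∀ {n m} → n ∣ m → m < n → m ≡ 0
  ∣-<⇒≡0 {m = zero} _ _ = refl
  ∣-<⇒≡0 {m = suc _} n∣m m<n = contradiction (∣⇒≤ n∣m) (<⇒≱ m<n)

  inverse-unique-≤ : ∀ {n a b b′} → InG n (a , b) → InG n (a , b′) → b ≤ b′ → b ≡ b′
  inverse-unique-≤ {n} {a} {b} {b′} (1≤a , _ , 1≤b , b≤n-1 , n∣ab-1) (_ , _ , _ , b′≤n-1 , n∣ab′-1) b≤b′ =
    ≤-antisym b≤b′ (m∸n≡0⇒m≤n (∣-<⇒≡0 n∣b′-b b′-b<n))
    where
    1≤ab : 1 ≤ a * b
    1≤ab = *-mono-≤ 1≤a 1≤b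
    coprime : Coprime n a
    coprime {d} (d∣n , d∣a) =
      ∣1⇒≡1 (∣m+n∣m⇒∣n (subst (d ∣_) (sym (m∸n+n≡m 1≤ab)) (∣m⇒∣m*n b d∣a)) (∣-trans d∣n n∣ab-1))
    ab′-1 : a * b′ ∸ 1 ≡ (a * b ∸ 1) + a * (b′ ∸ b)
    ab′-1 = begin
      a * b′ ∸ 1                       ≡⟨ cong (λ t → a * t ∸ 1) (m+[n∸m]≡n b≤b′) ⟨
      a * (b + (b′ ∸ b)) ∸ 1           ≡⟨ cong (_∸ 1) (*-distribˡ-+ a b (b′ ∸ b)) ⟩
      a * b + a * (b′ ∸ b) ∸ 1         ≡⟨ +-∸-comm (a * (b′ ∸ b)) 1≤ab ⟩
      (a * b ∸ 1) + a * (b′ ∸ b)       ∎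
      where open ≡-Reasoning
    n∣b′-b : n ∣ b′ ∸ b
    n∣b′-b = coprime-divisor coprime (∣m+n∣m⇒∣n (subst (n ∣_) ab′-1 n∣ab′-1) n∣ab-1)
    b′-b<n : b′ ∸ b < n
    b′-b<n = ≤-<-trans (≤-trans (m∸n≤m b′ b) b′≤n-1)
                       (∸-monoʳ-< (s≤s z≤n) (≤-trans 1≤b (≤-trans b≤n-1 (m∸n≤m n 1))))

  inverse-unique : ∀ {n a b b′} → InG n (a , b) → InG n (a , b′) → b ≡ b′
  inverse-unique {b = b} {b′} g g′ with ≤-total b b′
  ... | inj₁ b≤b′ = inverse-unique-≤ g g′ b≤b′
  ... | inj₂ b′≤b = sym (inverse-unique-≤ g′ g b′≤b)

module Arithmetic where
  open Chains using (chainBound)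
  open import Data.Nat
  open import Data.Nat.Properties
  open import Data.Nat.Tactic.RingSolver using (solve-∀)

  _⁴ : ℕ → ℕ
  k ⁴ = k * k * (k * k)

  ⁴-mono-≤ : ∀ {m n} → m ≤ n → m ⁴ ≤ n ⁴
  ⁴-mono-≤ m≤n = *-mono-≤ (*-mono-≤ m≤n m≤n) (*-mono-≤ m≤n m≤n)

  n≤n⁴ : ∀ {n} → 1 ≤ n → n ≤ n ⁴
  n≤n⁴ {n} 1≤n = begin
    n          ≡⟨ *-identityʳ n ⟨
    n * 1      ≤⟨ *-monoʳ-≤ n (*-mono-≤ 1≤n (*-mono-≤ 1≤n 1≤n)) ⟩
    n * (n * (n * n)) ≡⟨ *-assoc n n (n * n) ⟨
    n ⁴        ∎
    where open ≤-Reasoning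

  ⁴-<-suc : ∀ k → k ⁴ < (suc k) ⁴
  ⁴-<-suc k = subst (k ⁴ <_) (sym (expand k)) (s≤s (m≤m+n (k ⁴) _))
    where
    expand : ∀ k → (1 + k) * (1 + k) * ((1 + k) * (1 + k)) ≡ 1 + (k * k * (k * k) + (4 * (k * k * k) + 6 * (k * k) + 4 * k))
    expand = solve-∀

  suc⁴≤16* : ∀ {k} → 1 ≤ k → (suc k) ⁴ ≤ 16 * k ⁴
  suc⁴≤16* {k} 1≤k = ≤-trans (⁴-mono-≤ (+-monoˡ-≤ k 1≤k)) (≤-reflexive (double k))
    where
    double : ∀ k → (k + k) * (k + k) * ((k + k) * (k + k)) ≡ 16 * (k * k * (k * k))
    double = solve-∀

  fourthRoot : ∀ n → 1 ≤ n → ∃ λ k → 1 ≤ k × k ⁴ ≤ n × n < (suc k) ⁴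
  fourthRoot (suc zero) _ = 1 , s≤s z≤n , s≤s z≤n , s≤s (s≤s z≤n)
  fourthRoot (suc (suc n)) _ with fourthRoot (suc n) (s≤s z≤n)
  ... | k , 1≤k , k⁴≤ , <suc⁴ with suc (suc n) <? (suc k) ⁴
  ...   | yes <suc⁴′ = k , 1≤k , m≤n⇒m≤1+n k⁴≤ , <suc⁴′
  ...   | no ≮suc⁴ = suc k , s≤s z≤n , ≮⇒≥ ≮suc⁴ , ≤-<-trans <suc⁴ (⁴-<-suc (suc k))

  length⁴≤ : ∀ {n k L} → 1 ≤ k → k ⁴ ≤ n → n < (suc k) ⁴ →
             k * L ≤ chainBound n k + (chainBound n k + k * 2) → L ⁴ ≤ 16 * 16 ⁴ * (n * n * n)
  length⁴≤ {n} {k} {L} 1≤k k⁴≤n n<suc⁴ kL≤ = *-cancelʳ-≤ (L ⁴) (16 * 16 ⁴ * (n * n * n)) n {{>-nonZero 1≤n}} (begin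
    L ⁴ * n              ≤⟨ *-monoʳ-≤ (L ⁴) (≤-trans (<⇒≤ n<suc⁴) (suc⁴≤16* 1≤k)) ⟩
    L ⁴ * (16 * k ⁴)     ≡⟨ regroup L k ⟩
    16 * (k * L) ⁴       ≤⟨ *-monoʳ-≤ 16 (⁴-mono-≤ kL≤16n) ⟩
    16 * (16 * n) ⁴      ≡⟨ expand 16 n ⟩
    16 * 16 ⁴ * (n * n * n) * n ∎)
    where
    open ≤-Reasoning
    1≤n : 1 ≤ n
    1≤n = ≤-trans (≤-trans 1≤k (n≤n⁴ 1≤k)) k⁴≤n
    kL≤16n : k * L ≤ 16 * n
    kL≤16n = begin
      k * L                            ≤⟨ kL≤ ⟩
      chainBound n k + (chainBound n k + k * 2) ≡⟨ collect n k ⟩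
      6 * k + 6 * n + 4 * k ⁴
        ≤⟨ +-mono-≤ (+-monoˡ-≤ (6 * n) (*-monoʳ-≤ 6 (≤-trans (n≤n⁴ 1≤k) k⁴≤n))) (*-monoʳ-≤ 4 k⁴≤n) ⟩
      6 * n + 6 * n + 4 * n            ≡⟨ sixteen n ⟩
      16 * n                           ∎
      where
      collect : ∀ n k → k + (n + (n + n) + k * suc (2 * (k * k * k))) + (k + (n + (n + n) + k * suc (2 * (k * k * k))) + k * 2)
                        ≡ 6 * k + 6 * n + 4 * (k * k * (k * k))
      collect = solve-∀
      sixteen : ∀ n → 6 * n + 6 * n + 4 * n ≡ 16 * n
      sixteen = solve-∀
    regroup : ∀ L k → L * L * (L * L) * (16 * (k * k * (k * k))) ≡ 16 * ((k * L) * (k * L) * ((k * L) * (k * L)))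
    regroup = solve-∀
    expand : ∀ c n → c * ((c * n) * (c * n) * ((c * n) * (c * n))) ≡ c * (c * c * (c * c)) * (n * n * n) * n
    expand = solve-∀

  *-^ : ∀ a b k → (a * b) ^ k ≡ a ^ k * b ^ k
  *-^ a b zero = refl
  *-^ a b (suc k) = trans (cong (a * b *_) (*-^ a b k)) (interchange a b (a ^ k) (b ^ k))
    where
    interchange : ∀ a b x y → a * b * (x * y) ≡ a * x * (b * y)
    interchange = solve-∀

  n≤n^suc : ∀ n e → n ≤ n ^ suc e
  n≤n^suc zero e = z≤n
  n≤n^suc n@(suc _) e = m≤m*n n (n ^ e) {{m^n≢0 n e}}

  power-bound : ∀ {C L n e} Q → L ⁴ ≤ C * (n * n * n) → C ^ Q ≤ n → L ^ (4 * Q) ≤ n ^ (3 * Q + suc e)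
  power-bound {C} {L} {n} {e} Q L⁴≤ C^Q≤n = begin
    L ^ (4 * Q)               ≡⟨ ^-*-assoc L 4 Q ⟨
    (L ^ 4) ^ Q               ≡⟨ cong (_^ Q) (fourth L) ⟩
    (L ⁴) ^ Q                 ≤⟨ ^-monoˡ-≤ Q L⁴≤ ⟩
    (C * (n * n * n)) ^ Q     ≡⟨ *-^ C (n * n * n) Q ⟩
    C ^ Q * (n * n * n) ^ Q   ≤⟨ *-monoˡ-≤ _ (≤-trans C^Q≤n (n≤n^suc n e)) ⟩
    n ^ suc e * (n * n * n) ^ Q ≡⟨ cong (λ t → n ^ suc e * t ^ Q) (cube n) ⟩
    n ^ suc e * (n ^ 3) ^ Q   ≡⟨ cong (n ^ suc e *_) (^-*-assoc n 3 Q) ⟩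
    n ^ suc e * n ^ (3 * Q)   ≡⟨ *-comm (n ^ suc e) _ ⟩
    n ^ (3 * Q) * n ^ suc e   ≡⟨ ^-distribˡ-+-* n (3 * Q) (suc e) ⟨
    n ^ (3 * Q + suc e)       ∎
    where
    open ≤-Reasoning
    fourth : ∀ L → L * (L * (L * (L * 1))) ≡ L * L * (L * L)
    fourth = solve-∀
    cube : ∀ n → n * n * n ≡ n * (n * (n * 1))
    cube = solve-∀

module VertexLists where
  open Chains using (InBox)
  open IntegerHull using (IntHullOfOthers)
  open SortByX using (DistinctX)
  open ListFacts using (allPairs-restrict)
  open ConvexPositionCount using (ConvexPosition)
  open RationalHull using (intHull⇒hull)
  open ModularInverse using (inverse-unique)
  open import Data.Nat.Properties using (≤-trans; m∸n≤m)
  open import Data.List.Membership.Propositional using (_∈_)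

  vertexList⇒convexPosition : ∀ {n vs} → IsVertexList n vs → ConvexPosition n vs
  vertexList⇒convexPosition {n} {vs} (unique , vertices) = record
    { inBox = All.map inBox vertices
    ; distinctX = allPairs-restrict distinct (All.map proj₁ vertices) unique
    ; extreme = extreme
    }
    where
    inG : ∀ {q} → q ∈ vs → InG n q
    inG q∈ = proj₁ (All.lookup vertices q∈)
    inBox : ∀ {p} → IsVertex n p → InBox n p
    inBox ((_ , a≤ , _ , b≤ , _) , _) = ≤-trans a≤ (m∸n≤m n 1) , ≤-trans b≤ (m∸n≤m n 1)
    distinct : ∀ {p q} → InG n p → InG n q → p ≢ q → DistinctX p q
    distinct {a , b} {a′ , b′} gp gq p≢q a≡a′ rewrite a≡a′ = p≢q (cong (a′ ,_) (inverse-unique gp gq))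
    extreme : ∀ {p} → p ∈ vs → ¬ IntHullOfOthers vs p
    extreme p∈ hull = proj₂ (All.lookup vertices p∈) (intHull⇒hull inG hull)

open Arithmetic using (fourthRoot; length⁴≤; power-bound; _⁴)
open ConvexPositionCount using (length-convexPosition≤)
open VertexLists using (vertexList⇒convexPosition)
open import Data.Nat.Properties using (≤-trans; m^n>0)

open import Data.Nat using (ℕ; _≤_; _^_; _*_; _+_; suc)
open import Data.Product using (∃)
open import Data.List using (List; length)

theorem11 : (p q : ℕ) → ∃ λ n₀ → (n : ℕ) → n₀ ≤ n →
    (vs : List Point) → IsVertexList n vs →
    length vs ^ (4 * suc q) ≤ n ^ (3 * suc q + 4 * suc p)
theorem11 p q = (16 * 16 ⁴) ^ suc q , bound
  where
  bound : (n : ℕ) → (16 * 16 ⁴) ^ suc q ≤ n → (vs : List Point) → IsVertexList n vs →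
          length vs ^ (4 * suc q) ≤ n ^ (3 * suc q + 4 * suc p)
  bound n C^Q≤n vs isVertexList =
    let K , 1≤K , K⁴≤n , n<suc⁴ = fourthRoot n (≤-trans (m^n>0 (16 * 16 ⁴) (suc q)) C^Q≤n) in
    power-bound {C = 16 * 16 ⁴} {L = length vs} {n = n} (suc q)
      (length⁴≤ 1≤K K⁴≤n n<suc⁴ (length-convexPosition≤ K vs (vertexList⇒convexPosition isVertexList))) C^Q≤n
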